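{- Let $M$ be a max shuffle on $S_n$ and $w\in S_n$. If $w(1)=M(w)(1)$, then $w(1)=1$ and $M(w)=w$.
   Context: $[n]=\{1,\dots,n\}$, $[a,b]=\{a,\dots,b\}$; $S_n$ is the group of bijections $[n]\to[n]$. A homing shuffle is a map $F:S_n\to S_n$ such that for every $w\in S_n$, setting $k:=w(1)$: (a) $F(w)(k)=k$, and (b) $F(w)(i)=w(i)$ for all $i>k$. A max shuffle is a homing shuffle $M$ such that for every $w\in S_n$ with $w(1)\neq1$, $M(w)(1)=\max(w([2,k]))$ where $k=w(1)$. -}

module Defs where

open import Data.Nat using (ℕ; suc)
open import Data.Fin using (Fin; zero; _≤_; _<_)
open import Data.Fin.Permutation using (Permutation′; _⟨$⟩ʳ_)
open import Data.Product using (Σ; _×_; _,_)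
open import Relation.Binary.PropositionalEquality using (_≡_)
open import Relation.Nullary using (¬_)

-- Convention: [m] = {1,…,m} is represented by Fin m, with the element i ∈ [m]
-- represented by the Fin value i-1.  So "1" is `zero` and the usual order is
-- preserved.

_≗ₚ_ : ∀ {m} → Permutation′ m → Permutation′ m → Set
_≗ₚ_ {m} u v = (i : Fin m) → u ⟨$⟩ʳ i ≡ v ⟨$⟩ʳ i

IsHomingShuffle : ∀ {n} → (Permutation′ (suc n) → Permutation′ (suc n)) → Set
IsHomingShuffle {n} F =
  (w : Permutation′ (suc n)) →
    (F w ⟨$⟩ʳ (w ⟨$⟩ʳ zero) ≡ w ⟨$⟩ʳ zero)
    × ((i : Fin (suc n)) → (w ⟨$⟩ʳ zero) < i → F w ⟨$⟩ʳ i ≡ w ⟨$⟩ʳ i)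

-- x = max (w([2,k])) where k = w(1): x is the value w(j) at some position
-- j with 2 ≤ j ≤ k, and every such value is ≤ x.
IsMaxOfPrefix : ∀ {n} → Permutation′ (suc n) → Fin (suc n) → Set
IsMaxOfPrefix {n} w x =
  Σ (Fin (suc n)) (λ j → (zero {n} < j) × (j ≤ (w ⟨$⟩ʳ zero)) × (w ⟨$⟩ʳ j ≡ x))
  × ((j : Fin (suc n)) → zero {n} < j → j ≤ (w ⟨$⟩ʳ zero) → (w ⟨$⟩ʳ j) ≤ x)

IsMaxShuffle : ∀ {n} → (Permutation′ (suc n) → Permutation′ (suc n)) → Set
IsMaxShuffle {n} M =
  IsHomingShuffle M
  × ((w : Permutation′ (suc n)) → ¬ (w ⟨$⟩ʳ zero ≡ zero) →
       IsMaxOfPrefix w (M w ⟨$⟩ʳ zero))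

module Submission where

open import Defs
open import Data.Nat using (ℕ; suc)
open import Data.Fin using (Fin; zero; suc; _<_; _≟_)
open import Data.Fin.Permutation using (Permutation′; _⟨$⟩ʳ_)
open import Data.Fin.Properties using (<⇒≢)
open import Data.Nat.Base using (z<s)
open import Data.Product using (_×_; _,_; proj₁; proj₂)
open import Function.Bundles using (Injection)
open import Function.Properties.Inverse using (↔⇒↣)
open import Relation.Binary.PropositionalEquality using (_≡_; _≢_; sym; trans; cong; subst; module ≡-Reasoning)
open import Relation.Nullary using (yes; no; contradiction)

permutation-injective : ∀ {m} (π : Permutation′ m) {i j : Fin m} →
  π ⟨$⟩ʳ i ≡ π ⟨$⟩ʳ j → i ≡ j
permutation-injective π = Injection.injective (↔⇒↣ π)

-- The maximum is attained at a position j ≥ 2, and w is injective.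
maxOfPrefix≢head : ∀ {n} (w : Permutation′ (suc n)) {x : Fin (suc n)} →
  IsMaxOfPrefix w x → x ≢ w ⟨$⟩ʳ zero
maxOfPrefix≢head w ((j , 0<j , _ , wj≡x) , _) x≡w0 =
  <⇒≢ 0<j (sym (permutation-injective w (trans wj≡x x≡w0)))

homing-fixes-if-head-zero : ∀ {n} {F : Permutation′ (suc n) → Permutation′ (suc n)} →
  IsHomingShuffle F → (w : Permutation′ (suc n)) →
  w ⟨$⟩ʳ zero ≡ zero → F w ≗ₚ w
homing-fixes-if-head-zero {F = F} hom w w0≡0 zero = begin
  F w ⟨$⟩ʳ zero            ≡⟨ cong (F w ⟨$⟩ʳ_) (sym w0≡0) ⟩
  F w ⟨$⟩ʳ (w ⟨$⟩ʳ zero)   ≡⟨ proj₁ (hom w) ⟩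
  w ⟨$⟩ʳ zero              ∎
  where open ≡-Reasoning
homing-fixes-if-head-zero hom w w0≡0 (suc i) =
  proj₂ (hom w) (suc i) (subst (_< suc i) (sym w0≡0) z<s)

lemma7 : (n : ℕ) (M : Permutation′ (suc n) → Permutation′ (suc n)) →
    IsMaxShuffle M → (w : Permutation′ (suc n)) →
    w ⟨$⟩ʳ zero ≡ M w ⟨$⟩ʳ zero →
    (w ⟨$⟩ʳ zero ≡ zero) × (M w ≗ₚ w)
lemma7 n M (homing , headIsMax) w w0≡Mw0 =
  w0≡0 , homing-fixes-if-head-zero {F = M} homing w w0≡0
  where
  w0≡0 : w ⟨$⟩ʳ zero ≡ zero
  w0≡0 with w ⟨$⟩ʳ zero ≟ zero
  ... | yes w0≡0 = w0≡0
  ... | no w0≢0 = contradiction (sym w0≡Mw0) (maxOfPrefix≢head w (headIsMax w w0≢0))
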